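{- Let $k\ge 4$. Suppose that for every $k$-element set $F\subseteq[k+1]$ we are given a cyclic permutation $\pi_F$ of $F$ such that for every pair of $k$-element sets $F,F'\subseteq[k+1]$ the cyclic permutations $\pi_F$ and $\pi_{F'}$ are compatible. Then there is a cyclic permutation of $[k+1]$ compatible with all the cyclic permutations $\pi_F$, $F\in\binom{[k+1]}{k}$.
   Context: $[k+1]=\{1,\dots,k+1\}$. Two cyclic permutations of sets $A$ and $B$ are compatible if they are restrictions of a common cyclic permutation of $A\cup B$ (where the restriction of a cyclic order to a subset is the induced cyclic order). -}

module Defs where

open import Data.Nat using (ℕ; zero; suc; _<_)
open import Data.Fin using (Fin)
open import Data.Fin.Subset using (Subset; _∈_; _∉_; _∪_)
open import Data.Product using (_×_; ∃)
open import Relation.Binary.PropositionalEquality using (_≡_)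

iter : {n : ℕ} → (Fin n → Fin n) → ℕ → Fin n → Fin n
iter f zero x = x
iter f (suc i) x = f (iter f i x)

-- σ (a map on Fin n, only its values on A matter) is a cyclic permutation of
-- the set A ⊆ Fin n: it maps A into A, is injective on A, and consists of a
-- single cycle (every element of A is reachable from every other one).
IsCyclicPerm : {n : ℕ} → Subset n → (Fin n → Fin n) → Set
IsCyclicPerm A σ =
  (∀ x → x ∈ A → σ x ∈ A) ×
  (∀ x y → x ∈ A → y ∈ A → σ x ≡ σ y → x ≡ y) ×
  (∀ x y → x ∈ A → y ∈ A → ∃ λ i → iter σ i x ≡ y)

-- The restriction of τ to A (induced cyclic order) equals σ on A:
-- for a ∈ A, σ a is the first iterate τ^(i+1) a (i ≥ 0) lying in A.
RestrictsTo : {n : ℕ} → (Fin n → Fin n) → Subset n → (Fin n → Fin n) → Set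
RestrictsTo τ A σ =
  ∀ a → a ∈ A → ∃ λ i → (iter τ (suc i) a ≡ σ a) × (∀ j → j < i → iter τ (suc j) a ∉ A)

Compatible : {n : ℕ} → Subset n → (Fin n → Fin n) → Subset n → (Fin n → Fin n) → Set
Compatible A σ B ρ =
  ∃ λ τ → IsCyclicPerm (A ∪ B) τ × RestrictsTo τ A σ × RestrictsTo τ B ρ

-- Write π∖ z for the given cyclic order on [k+1] ∖ {z}, and skip z μ for the restriction of
-- a cyclic order μ of [k+1] to [k+1] ∖ {z}. Skipping two distinct points commutes, and a cyclic
-- order is determined by its skips at two points that are not adjacent in it. Compatibility of
-- π∖ x and π∖ y gives a cyclic order ν x y of [k+1] with skips π∖ x and π∖ y; among x, y and
-- π∖ x y some pair is non-adjacent in its ν, and μ = ν x y then restricts to every π∖ z: skipping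
-- x, resp. y, in skip z μ and in π∖ z gives the same result (compare both with π∖ x, resp. π∖ y,
-- with z skipped), so they agree unless z sits between x and y in μ, when one passes through the
-- point μ y first. The hypothesis k ≥ 4 excludes cycles of length at most 4 in μ.

module Submission where

open import Defs
open import Data.Nat using (ℕ; zero; suc; _≤_; _<_; z≤n; s≤s; _∸_)
import Data.Nat.Properties as ℕ
open import Data.Fin using (Fin; toℕ; fromℕ<; _≟_) renaming (zero to fzero; suc to fsuc)
open import Data.Fin.Properties using (any?; all?; ¬∀⟶∃¬; injective⇒≤; toℕ-fromℕ<)
open import Data.Fin.Subset using (Subset; ⊤; ∣_∣; _∈_; ∁; ⁅_⁆; _∪_)
open import Data.Fin.Subset.Properties
  using (_∈?_; ∈⊤; ⊆⊤; ⊆-antisym; ∣⊤∣≡n; ∣∁p∣≡n∸∣p∣; ∣⁅x⁆∣≡1; x≢y⇒x∉⁅y⁆; x∈⁅x⁆;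
         x∉p⇒x∈∁p; x∈∁p⇒x∉p; x∈p∪q⁺; p⊂q⇒∣p∣<∣q∣; ∪-zeroˡ)
open import Data.Product using (_×_; _,_; ∃; ∃₂; proj₁; proj₂)
open import Data.Sum using (_⊎_; inj₁; inj₂; [_,_]′; swap)
open import Data.Empty using (⊥; ⊥-elim)
open import Function using (_∘_)
open import Function.Definitions using (Injective)
open import Level using (_⊔_)
open import Relation.Binary.Definitions using (DecidableEquality)
open import Relation.Nullary using (¬_; Dec; yes; no; ¬?; contradiction)
open import Relation.Nullary.Decidable using (decidable-stable; toSum; _×-dec_; _⊎-dec_)
open import Relation.Unary using (Pred)
open import Relation.Binary.PropositionalEquality
open ≡-Reasoning

smaller-map-misses : ∀ {m n} → m < n → (g : Fin m → Fin n) → ∃ λ b → ∀ i → g i ≢ b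
smaller-map-misses {m} m<n g with any? (λ b → all? (λ i → ¬? (g i ≟ b)))
... | yes missed = missed
... | no ¬missed = contradiction (injective⇒≤ preimage-injective) (ℕ.<⇒≱ m<n)
  where
  preimage : ∀ b → ∃ λ i → g i ≡ b
  preimage b with ¬∀⟶∃¬ m (λ i → g i ≢ b) (λ i → ¬? (g i ≟ b)) (λ none → ¬missed (b , none))
  ... | i , ¬¬hit = i , decidable-stable (g i ≟ b) ¬¬hit

  preimage-injective : Injective _≡_ _≡_ (proj₁ ∘ preimage)
  preimage-injective {b} {c} eq =
    trans (sym (proj₂ (preimage b))) (trans (cong g eq) (proj₂ (preimage c)))

iter-periodic : ∀ {n} (f : Fin n → Fin n) a m → iter f (suc m) a ≡ a →
                ∀ i → ∃ λ j → j ≤ m × iter f i a ≡ iter f j a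
iter-periodic f a m period zero = 0 , z≤n , refl
iter-periodic f a m period (suc i) with iter-periodic f a m period i
... | j , j≤m , eq with j ℕ.≟ m
...   | yes refl = 0 , z≤n , trans (cong f eq) period
...   | no j≢m = suc j , ℕ.≤∧≢⇒< j≤m j≢m , cong f eq

reach-within-period : ∀ {n} {A : Subset n} {f} → IsCyclicPerm A f → ∀ {a b} → a ∈ A → b ∈ A →
                      ∀ m → iter f (suc m) a ≡ a → ∃ λ j → j ≤ m × iter f j a ≡ b
reach-within-period {f = f} (_ , _ , reach) {a} a∈A b∈A m period with reach a _ a∈A b∈A
... | i , hit with iter-periodic f a m period i
... | j , j≤m , eq = j , j≤m , trans (sym eq) hit

⊤-cycle-long : ∀ {n f} → IsCyclicPerm ⊤ f → ∀ {m} → suc m < n → ∀ a → iter f (suc m) a ≢ a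
⊤-cycle-long {f = f} cyclic {m} m<n a period with smaller-map-misses m<n (λ j → iter f (toℕ j) a)
... | b , missed with reach-within-period cyclic {b = b} ∈⊤ ∈⊤ m period
... | j , j≤m , hit =
  missed (fromℕ< (s≤s j≤m)) (subst (λ i → iter f i a ≡ b) (sym (toℕ-fromℕ< (s≤s j≤m))) hit)

all-but : ∀ {n} → Fin n → Subset n
all-but z = ∁ ⁅ z ⁆

∈-all-but⁺ : ∀ {n} {z b : Fin n} → b ≢ z → b ∈ all-but z
∈-all-but⁺ b≢z = x∉p⇒x∈∁p (x≢y⇒x∉⁅y⁆ b≢z)

∈-all-but⁻ : ∀ {n} {z b : Fin n} → b ∈ all-but z → b ≢ z
∈-all-but⁻ {z = z} b∈ refl = x∈∁p⇒x∉p b∈ (x∈⁅x⁆ z)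

∣all-but∣ : ∀ {n} (z : Fin (suc n)) → ∣ all-but z ∣ ≡ n
∣all-but∣ {n} z = trans (∣∁p∣≡n∸∣p∣ ⁅ z ⁆) (cong (suc n ∸_) (∣⁅x⁆∣≡1 z))

all-but-∪ : ∀ {n} {x y : Fin n} → x ≢ y → all-but x ∪ all-but y ≡ ⊤
all-but-∪ {x = x} x≢y = ⊆-antisym ⊆⊤ (λ {b} _ → x∈p∪q⁺ (cover b))
  where
  cover : ∀ b → b ∈ all-but x ⊎ b ∈ all-but _
  cover b with b ≟ x
  ... | yes refl = inj₂ (∈-all-but⁺ x≢y)
  ... | no b≢x = inj₁ (∈-all-but⁺ b≢x)

∣p∣≡n⇒all-but : ∀ {n} (F : Subset (suc n)) → ∣ F ∣ ≡ n → ∃ λ z → F ≡ all-but z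
∣p∣≡n⇒all-but {n} F ∣F∣≡n with any? (λ z → ¬? (z ∈? F))
... | no all-in = contradiction (trans (sym (trans (cong ∣_∣ F≡⊤) (∣⊤∣≡n (suc n)))) ∣F∣≡n) ℕ.1+n≢n
  where
  F≡⊤ : F ≡ ⊤
  F≡⊤ = ⊆-antisym ⊆⊤ (λ {x} _ → decidable-stable (x ∈? F) (λ x∉F → all-in (x , x∉F)))
... | yes (z , z∉F) = z , ⊆-antisym F⊆all-but all-but⊆F
  where
  F⊆all-but : ∀ {x} → x ∈ F → x ∈ all-but z
  F⊆all-but x∈F = ∈-all-but⁺ (λ { refl → z∉F x∈F })

  all-but⊆F : ∀ {x} → x ∈ all-but z → x ∈ F
  all-but⊆F {x} x∈ = decidable-stable (x ∈? F) λ x∉F →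
    ℕ.<-irrefl (trans ∣F∣≡n (sym (∣all-but∣ z))) (p⊂q⇒∣p∣<∣q∣ (F⊆all-but , x , x∈ , x∉F))

all-but-cycle-long : ∀ {n z f} → IsCyclicPerm (all-but z) f → ∀ {m} → suc (suc m) < n →
                     ∀ {a} → a ≢ z → iter f (suc m) a ≢ a
all-but-cycle-long {z = z} {f} cyclic {m} m<n {a} a≢z period with smaller-map-misses m<n orbit
  where
  orbit : Fin (suc (suc m)) → _
  orbit fzero = z
  orbit (fsuc j) = iter f (toℕ j) a
... | b , missed
  with reach-within-period cyclic {b = b} (∈-all-but⁺ a≢z) (∈-all-but⁺ (missed fzero ∘ sym)) m period
... | j , j≤m , hit =
  missed (fsuc (fromℕ< (s≤s j≤m))) (subst (λ i → iter f i a ≡ b) (sym (toℕ-fromℕ< (s≤s j≤m))) hit)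

-- skip z f is the successor function f with the point z jumped over, i.e. the
-- restriction of a cyclic order to the complement of z.
module Skip {a} {A : Set a} (_≟ᴬ_ : DecidableEquality A) where

  skip : A → (A → A) → A → A
  skip z f x with f x ≟ᴬ z
  ... | yes _ = f (f x)
  ... | no _ = f x

  Adjacent : (A → A) → A → A → Set a
  Adjacent f x y = f x ≡ y ⊎ f y ≡ x

  Between : (A → A) → A → A → A → Set a
  Between f x z y = f x ≡ z × f z ≡ y

  adjacent? : ∀ f x y → Dec (Adjacent f x y)
  adjacent? f x y = (f x ≟ᴬ y) ⊎-dec (f y ≟ᴬ x)

  between? : ∀ f x z y → Dec (Between f x z y)
  between? f x z y = (f x ≟ᴬ z) ×-dec (f z ≟ᴬ y)

  module _ {z : A} {f : A → A} {x : A} where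

    skip-hit : f x ≡ z → skip z f x ≡ f z
    skip-hit fx≡z with f x ≟ᴬ z
    ... | yes _ = cong f fx≡z
    ... | no fx≢z = contradiction fx≡z fx≢z

    skip-miss : f x ≢ z → skip z f x ≡ f x
    skip-miss fx≢z with f x ≟ᴬ z
    ... | yes fx≡z = contradiction fx≡z fx≢z
    ... | no _ = refl

    skip-≡-inv : ∀ {y} → skip z f x ≡ y → f x ≡ y ⊎ Between f x z y
    skip-≡-inv eq with f x ≟ᴬ z
    ... | yes fx≡z = inj₂ (fx≡z , trans (cong f (sym fx≡z)) eq)
    ... | no _ = inj₁ eq

  -- Splitting on toSum rather than on the Dec itself keeps skip folded in the goal.
  skip-cong : ∀ {z f g x} → f x ≡ g x → f (f x) ≡ g (f x) → skip z f x ≡ skip z g x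
  skip-cong {z} {f} {g} {x} fx≡gx ffx≡gfx with toSum (f x ≟ᴬ z)
  ... | inj₁ fx≡z = begin
    skip z f x      ≡⟨ skip-hit fx≡z ⟩
    f z             ≡⟨ cong f (sym fx≡z) ⟩
    f (f x)         ≡⟨ ffx≡gfx ⟩
    g (f x)         ≡⟨ cong g fx≡z ⟩
    g z             ≡⟨ sym (skip-hit (trans (sym fx≡gx) fx≡z)) ⟩
    skip z g x      ∎
  ... | inj₂ fx≢z = begin
    skip z f x      ≡⟨ skip-miss fx≢z ⟩
    f x             ≡⟨ fx≡gx ⟩
    g x             ≡⟨ sym (skip-miss (fx≢z ∘ trans fx≡gx)) ⟩
    skip z g x      ∎

  skip-miss-cancel : ∀ {w f g x} → skip w f x ≡ skip w g x → f x ≢ w → g x ≢ w → f x ≡ g x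
  skip-miss-cancel eq fx≢w gx≢w = trans (sym (skip-miss fx≢w)) (trans eq (skip-miss gx≢w))

  skip-nonadjacent : ∀ {f z u v} → ¬ Adjacent f u v → ¬ Between f u z v → ¬ Between f v z u →
                     ¬ Adjacent (skip z f) u v
  skip-nonadjacent nonadj ¬uzv ¬vzu (inj₁ eq) = [ nonadj ∘ inj₁ , ¬uzv ]′ (skip-≡-inv eq)
  skip-nonadjacent nonadj ¬uzv ¬vzu (inj₂ eq) = [ nonadj ∘ inj₂ , ¬vzu ]′ (skip-≡-inv eq)

  module _ {f : A → A} (f-no-fixpoint : ∀ x → f x ≢ x) where

    skip-avoids : ∀ z x → skip z f x ≢ z
    skip-avoids z x with f x ≟ᴬ z
    ... | yes refl = f-no-fixpoint (f x)
    ... | no fx≢z = fx≢z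

    skip-no-fixpoint : (∀ x → f (f x) ≢ x) → ∀ z x → skip z f x ≢ x
    skip-no-fixpoint f-no-2-cycle z x with f x ≟ᴬ z
    ... | yes _ = f-no-2-cycle x
    ... | no _ = f-no-fixpoint x

  module _ {f : A → A} (f-injective : Injective _≡_ _≡_ f) where

    skip-injective : ∀ {z x y} → x ≢ z → y ≢ z → skip z f x ≡ skip z f y → x ≡ y
    skip-injective {z} {x} {y} x≢z y≢z eq with f x ≟ᴬ z | f y ≟ᴬ z
    ... | yes fx≡z | yes fy≡z = f-injective (trans fx≡z (sym fy≡z))
    ... | yes fx≡z | no _ = contradiction (trans (sym (f-injective eq)) fx≡z) y≢z
    ... | no _ | yes fy≡z = contradiction (trans (f-injective eq) fy≡z) x≢z
    ... | no _ | no _ = f-injective eq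

    private
      skip-comm-hit : ∀ {z w x} → z ≢ w → x ≢ w → f x ≡ z → skip w (skip z f) x ≡ skip z (skip w f) x
      skip-comm-hit {z} {w} {x} z≢w x≢w fx≡z with toSum (f z ≟ᴬ w)
      ... | inj₁ fz≡w = begin
        skip w (skip z f) x  ≡⟨ skip-hit (trans (skip-hit fx≡z) fz≡w) ⟩
        skip z f w           ≡⟨ skip-miss (λ fw≡z → x≢w (sym (f-injective (trans fw≡z (sym fx≡z))))) ⟩
        f w                  ≡⟨ sym (skip-hit fz≡w) ⟩
        skip w f z           ≡⟨ sym (skip-hit (trans (skip-miss (z≢w ∘ trans (sym fx≡z))) fx≡z)) ⟩
        skip z (skip w f) x  ∎
      ... | inj₂ fz≢w = begin
        skip w (skip z f) x  ≡⟨ skip-miss (fz≢w ∘ trans (sym (skip-hit fx≡z))) ⟩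
        skip z f x           ≡⟨ skip-hit fx≡z ⟩
        f z                  ≡⟨ sym (skip-miss fz≢w) ⟩
        skip w f z           ≡⟨ sym (skip-hit (trans (skip-miss (z≢w ∘ trans (sym fx≡z))) fx≡z)) ⟩
        skip z (skip w f) x  ∎

    skip-comm : ∀ {z w x} → z ≢ w → x ≢ z → x ≢ w → skip w (skip z f) x ≡ skip z (skip w f) x
    skip-comm {z} {w} {x} z≢w x≢z x≢w with toSum (f x ≟ᴬ z) | toSum (f x ≟ᴬ w)
    ... | inj₁ fx≡z | _ = skip-comm-hit z≢w x≢w fx≡z
    ... | inj₂ _ | inj₁ fx≡w = sym (skip-comm-hit (z≢w ∘ sym) x≢z fx≡w)
    ... | inj₂ fx≢z | inj₂ fx≢w = begin
      skip w (skip z f) x  ≡⟨ skip-miss (fx≢w ∘ trans (sym (skip-miss fx≢z))) ⟩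
      skip z f x           ≡⟨ skip-miss fx≢z ⟩
      f x                  ≡⟨ sym (skip-miss fx≢w) ⟩
      skip w f x           ≡⟨ sym (skip-miss (fx≢z ∘ trans (sym (skip-miss fx≢w)))) ⟩
      skip z (skip w f) x  ∎

  SkipsAgree : ∀ {ℓ} → Pred A ℓ → (A → A) → (A → A) → A → Set (a ⊔ ℓ)
  SkipsAgree D ρ σ w = ∀ {x} → D x → x ≢ w → skip w ρ x ≡ skip w σ x

  module _ {ℓ} (D : Pred A ℓ) {ρ σ : A → A}
           (ρ-injective : ∀ {x y} → D x → D y → ρ x ≡ ρ y → x ≡ y)
           (ρ-no-fixpoint : ∀ {x} → D x → ρ x ≢ x) where

    private
      σ-hits : ∀ {w x} → SkipsAgree D ρ σ w → D x → x ≢ w → ρ x ≢ w → σ x ≡ w → ρ x ≡ σ w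
      σ-hits agree Dx x≢w ρx≢w σx≡w =
        trans (sym (skip-miss ρx≢w)) (trans (agree Dx x≢w) (skip-hit σx≡w))

      ρ-hits : ∀ {w x} → SkipsAgree D ρ σ w → D x → x ≢ w → ρ x ≡ w → σ x ≢ w → ρ w ≡ σ x
      ρ-hits agree Dx x≢w ρx≡w σx≢w =
        trans (sym (skip-hit ρx≡w)) (trans (agree Dx x≢w) (skip-miss σx≢w))

      agree-at-end : ∀ {u v} → D u → D v → u ≢ v → ¬ Adjacent ρ u v →
                     SkipsAgree D ρ σ u → SkipsAgree D ρ σ v → ρ u ≡ σ u
      agree-at-end {u} {v} Du Dv u≢v nonadj agree-u agree-v with σ u ≟ᴬ v
      ... | no σu≢v = skip-miss-cancel (agree-v Du u≢v) (nonadj ∘ inj₁) σu≢v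
      ... | yes σu≡v with σ v ≟ᴬ u
      ...   | yes σv≡u =
        contradiction (trans (σ-hits agree-v Du u≢v (nonadj ∘ inj₁) σu≡v) σv≡u) (ρ-no-fixpoint Du)
      ...   | no σv≢u = contradiction (ρ-injective Du Dv ρu≡ρv) u≢v
        where
        ρu≡ρv : ρ u ≡ ρ v
        ρu≡ρv = trans (σ-hits agree-v Du u≢v (nonadj ∘ inj₁) σu≡v)
                      (sym (skip-miss-cancel (agree-u Dv (u≢v ∘ sym)) (nonadj ∘ inj₂) σv≢u))

      crossing-impossible : ∀ {u v x} → SkipsAgree D ρ σ u → D x → x ≢ u → u ≢ v → ρ u ≢ v →
                            ρ x ≡ u → σ x ≡ v → ⊥
      crossing-impossible agree-u Dx x≢u u≢v ρu≢v ρx≡u σx≡v =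
        ρu≢v (trans (ρ-hits agree-u Dx x≢u ρx≡u (λ σx≡u → u≢v (trans (sym σx≡u) σx≡v))) σx≡v)

      agree-off-ends : ∀ {u v x} → D x → x ≢ u → x ≢ v → u ≢ v → ¬ Adjacent ρ u v →
                       SkipsAgree D ρ σ u → SkipsAgree D ρ σ v → ρ x ≡ σ x
      agree-off-ends {u} {v} {x} Dx x≢u x≢v u≢v nonadj agree-u agree-v with ρ x ≟ᴬ u | σ x ≟ᴬ u
      ... | yes ρx≡u | yes σx≡u = trans ρx≡u (sym σx≡u)
      ... | no ρx≢u | no σx≢u = skip-miss-cancel (agree-u Dx x≢u) ρx≢u σx≢u
      ... | yes ρx≡u | no _ with σ x ≟ᴬ v
      ...   | yes σx≡v = ⊥-elim (crossing-impossible agree-u Dx x≢u u≢v (nonadj ∘ inj₁) ρx≡u σx≡v)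
      ...   | no σx≢v = skip-miss-cancel (agree-v Dx x≢v) (u≢v ∘ trans (sym ρx≡u)) σx≢v
      agree-off-ends {u} {v} {x} Dx x≢u x≢v u≢v nonadj agree-u agree-v | no _ | yes σx≡u with ρ x ≟ᴬ v
      ...   | yes ρx≡v = ⊥-elim (crossing-impossible agree-v Dx x≢v (u≢v ∘ sym) (nonadj ∘ inj₂) ρx≡v σx≡u)
      ...   | no ρx≢v = skip-miss-cancel (agree-v Dx x≢v) ρx≢v (u≢v ∘ trans (sym σx≡u))

    skips-determine : ∀ {u v} → D u → D v → u ≢ v → ¬ Adjacent ρ u v →
                      SkipsAgree D ρ σ u → SkipsAgree D ρ σ v → ∀ {x} → D x → ρ x ≡ σ x
    skips-determine {u} {v} Du Dv u≢v nonadj agree-u agree-v {x} Dx with x ≟ᴬ u | x ≟ᴬ v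
    ... | yes refl | _ = agree-at-end Du Dv u≢v nonadj agree-u agree-v
    ... | no _ | yes refl = agree-at-end Dv Du (u≢v ∘ sym) (nonadj ∘ swap) agree-v agree-u
    ... | no x≢u | no x≢v = agree-off-ends Dx x≢u x≢v u≢v nonadj agree-u agree-v

module SkipFin {n : ℕ} = Skip (_≟_ {n})
open SkipFin

restricts-to-self : ∀ {n} (τ : Fin n → Fin n) A → RestrictsTo τ A τ
restricts-to-self τ A a _ = 0 , refl , λ _ ()

skip⇒restricts : ∀ {n z} {τ σ : Fin n → Fin n} → (∀ {a} → a ≢ z → skip z τ a ≡ σ a) →
                 RestrictsTo τ (all-but z) σ
skip⇒restricts {z = z} {τ} agree a a∈ with toSum (τ a ≟ z)
... | inj₂ τa≢z = 0 , trans (sym (skip-miss {f = τ} τa≢z)) (agree (∈-all-but⁻ a∈)) , λ _ ()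
... | inj₁ τa≡z = 1 , trans (cong τ τa≡z) (trans (sym (skip-hit {f = τ} τa≡z)) (agree (∈-all-but⁻ a∈))) ,
                  λ { zero _ τa∈ → ∈-all-but⁻ τa∈ τa≡z ; (suc _) (s≤s ()) }

restricts⇒skip : ∀ {n z} {τ σ : Fin n → Fin n} → (∀ a → τ a ≢ a) → (∀ {a} → a ≢ z → σ a ≢ z) →
                 RestrictsTo τ (all-but z) σ → ∀ {a} → a ≢ z → skip z τ a ≡ σ a
restricts⇒skip {z = z} {τ} τ-no-fixpoint σ-avoids restricts {a} a≢z
  with restricts a (∈-all-but⁺ a≢z) | toSum (τ a ≟ z)
... | zero , τa≡σa , _ | inj₂ τa≢z = trans (skip-miss {f = τ} τa≢z) τa≡σa
... | suc _ , _ , skipped | inj₂ τa≢z = contradiction (∈-all-but⁺ τa≢z) (skipped 0 (s≤s z≤n))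
... | zero , τa≡σa , _ | inj₁ τa≡z = contradiction (trans (sym τa≡σa) τa≡z) (σ-avoids a≢z)
... | suc zero , ττa≡σa , _ | inj₁ τa≡z = trans (skip-hit {f = τ} τa≡z) (trans (cong τ (sym τa≡z)) ττa≡σa)
... | suc (suc _) , _ , skipped | inj₁ τa≡z = contradiction (trans ττa≡z (sym τa≡z)) (τ-no-fixpoint (τ a))
  where
  ττa≡z : τ (τ a) ≡ z
  ττa≡z = decidable-stable (τ (τ a) ≟ z) (skipped 1 (s≤s (s≤s z≤n)) ∘ ∈-all-but⁺)

module CompatibleFamily (k : ℕ) (4≤k : 4 ≤ k) (π : Subset (suc k) → Fin (suc k) → Fin (suc k))
  (π-cyclic : ∀ F → ∣ F ∣ ≡ k → IsCyclicPerm F (π F))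
  (π-compatible : ∀ F F′ → ∣ F ∣ ≡ k → ∣ F′ ∣ ≡ k → Compatible F (π F) F′ (π F′)) where

  Point : Set
  Point = Fin (suc k)

  π∖ : Point → Point → Point
  π∖ z = π (all-but z)

  π∖-cyclic : ∀ z → IsCyclicPerm (all-but z) (π∖ z)
  π∖-cyclic z = π-cyclic (all-but z) (∣all-but∣ z)

  π∖-avoids : ∀ {z a} → a ≢ z → π∖ z a ≢ z
  π∖-avoids {z} {a} a≢z = ∈-all-but⁻ (proj₁ (π∖-cyclic z) a (∈-all-but⁺ a≢z))

  π∖-injective : ∀ {z a b} → a ≢ z → b ≢ z → π∖ z a ≡ π∖ z b → a ≡ b
  π∖-injective {z} {a} {b} a≢z b≢z = proj₁ (proj₂ (π∖-cyclic z)) a b (∈-all-but⁺ a≢z) (∈-all-but⁺ b≢z)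

  π∖-no-2-cycle : ∀ {z a} → a ≢ z → π∖ z (π∖ z a) ≢ a
  π∖-no-2-cycle = all-but-cycle-long (π∖-cyclic _) (s≤s (ℕ.<⇒≤ 4≤k))

  module FullCycle {μ : Point → Point} (μ-cyclic : IsCyclicPerm ⊤ μ) where

    μ-injective : Injective _≡_ _≡_ μ
    μ-injective {a} {b} = proj₁ (proj₂ μ-cyclic) a b ∈⊤ ∈⊤

    μ-no-fixpoint : ∀ a → μ a ≢ a
    μ-no-fixpoint = ⊤-cycle-long μ-cyclic (s≤s (ℕ.≤-trans (s≤s z≤n) 4≤k))

    μ-no-2-cycle : ∀ a → μ (μ a) ≢ a
    μ-no-2-cycle = ⊤-cycle-long μ-cyclic (s≤s (ℕ.≤-trans (s≤s (s≤s z≤n)) 4≤k))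

    μ-no-4-cycle : ∀ a → μ (μ (μ (μ a))) ≢ a
    μ-no-4-cycle = ⊤-cycle-long μ-cyclic (s≤s 4≤k)

  open FullCycle

  Induces : (Point → Point) → Point → Set
  Induces μ z = ∀ {a} → a ≢ z → skip z μ a ≡ π∖ z a

  π∖-compatible : ∀ x y → Compatible (all-but x) (π∖ x) (all-but y) (π∖ y)
  π∖-compatible x y = π-compatible (all-but x) (all-but y) (∣all-but∣ x) (∣all-but∣ y)

  ν : Point → Point → Point → Point
  ν x y = proj₁ (π∖-compatible x y)

  ν-cyclic : ∀ {x y} → x ≢ y → IsCyclicPerm ⊤ (ν x y)
  ν-cyclic {x} {y} x≢y = subst (λ A → IsCyclicPerm A (ν x y)) (all-but-∪ x≢y)
    (proj₁ (proj₂ (π∖-compatible x y)))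

  ν-induces-left : ∀ {x y} → x ≢ y → Induces (ν x y) x
  ν-induces-left {x} {y} x≢y = restricts⇒skip (μ-no-fixpoint (ν-cyclic x≢y)) π∖-avoids
    (proj₁ (proj₂ (proj₂ (π∖-compatible x y))))

  ν-induces-right : ∀ {x y} → x ≢ y → Induces (ν x y) y
  ν-induces-right {x} {y} x≢y = restricts⇒skip (μ-no-fixpoint (ν-cyclic x≢y)) π∖-avoids
    (proj₂ (proj₂ (proj₂ (π∖-compatible x y))))

  π∖-skip-comm : ∀ {x w a} → x ≢ w → a ≢ x → a ≢ w → skip w (π∖ x) a ≡ skip x (π∖ w) a
  π∖-skip-comm {x} {w} {a} x≢w a≢x a≢w = begin
    skip w (π∖ x) a      ≡⟨ skip-cong {f = π∖ x} {g = skip x μ}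
                              (sym (induces-x a≢x)) (sym (induces-x (π∖-avoids a≢x))) ⟩
    skip w (skip x μ) a  ≡⟨ skip-comm (μ-injective μ-cyclic) x≢w a≢x a≢w ⟩
    skip x (skip w μ) a  ≡⟨ skip-cong {f = skip w μ} {g = π∖ w}
                              (induces-w a≢w) (induces-w (skip-avoids (μ-no-fixpoint μ-cyclic) w a)) ⟩
    skip x (π∖ w) a      ∎
    where
    μ : Point → Point
    μ = ν x w
    μ-cyclic : IsCyclicPerm ⊤ μ
    μ-cyclic = ν-cyclic x≢w
    induces-x : Induces μ x
    induces-x = ν-induces-left x≢w
    induces-w : Induces μ w
    induces-w = ν-induces-right x≢w

  edge⇒π∖-swap : ∀ {μ x y} → IsCyclicPerm ⊤ μ → Induces μ x → Induces μ y → x ≢ y → μ x ≡ y →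
                 π∖ y x ≡ π∖ x y
  edge⇒π∖-swap {μ} {x} {y} μ-cyclic induces-x induces-y x≢y μx≡y = begin
    π∖ y x      ≡⟨ sym (induces-y x≢y) ⟩
    skip y μ x  ≡⟨ skip-hit {f = μ} μx≡y ⟩
    μ y         ≡⟨ sym (skip-miss {f = μ} μy≢x) ⟩
    skip x μ y  ≡⟨ induces-x (x≢y ∘ sym) ⟩
    π∖ x y      ∎
    where
    μy≢x : μ y ≢ x
    μy≢x = μ-no-2-cycle μ-cyclic x ∘ trans (cong μ μx≡y)

  adjacent⇒π∖-swap : ∀ {x y} → x ≢ y → Adjacent (ν x y) x y → π∖ y x ≡ π∖ x y
  adjacent⇒π∖-swap x≢y (inj₁ x→y) =
    edge⇒π∖-swap (ν-cyclic x≢y) (ν-induces-left x≢y) (ν-induces-right x≢y) x≢y x→y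
  adjacent⇒π∖-swap x≢y (inj₂ y→x) =
    sym (edge⇒π∖-swap (ν-cyclic x≢y) (ν-induces-right x≢y) (ν-induces-left x≢y) (x≢y ∘ sym) y→x)

  adjacent-triangle-impossible : ∀ {x y} → x ≢ y → Adjacent (ν x y) x y →
    Adjacent (ν x (π∖ x y)) x (π∖ x y) → Adjacent (ν y (π∖ x y)) y (π∖ x y) → ⊥
  adjacent-triangle-impossible {x} {y} x≢y xy-adjacent xw-adjacent yw-adjacent =
    x≢y (π∖-injective (w≢x ∘ sym) (w≢y ∘ sym) π∖wx≡π∖wy)
    where
    w : Point
    w = π∖ x y
    π∖yx≡w : π∖ y x ≡ w
    π∖yx≡w = adjacent⇒π∖-swap x≢y xy-adjacent
    w≢x : w ≢ x
    w≢x = π∖-avoids (x≢y ∘ sym)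
    w≢y : w ≢ y
    w≢y = π∖-avoids x≢y ∘ trans π∖yx≡w
    π∖wy≢x : π∖ w y ≢ x
    π∖wy≢x = π∖-no-2-cycle x≢y ∘ trans (cong (π∖ y) π∖yx≡w)
               ∘ trans (sym (adjacent⇒π∖-swap (w≢y ∘ sym) yw-adjacent))
    π∖wx≡π∖wy : π∖ w x ≡ π∖ w y
    π∖wx≡π∖wy = begin
      π∖ w x            ≡⟨ adjacent⇒π∖-swap (w≢x ∘ sym) xw-adjacent ⟩
      π∖ x w            ≡⟨ sym (skip-hit {f = π∖ x} refl) ⟩
      skip w (π∖ x) y   ≡⟨ π∖-skip-comm (w≢x ∘ sym) (x≢y ∘ sym) (w≢y ∘ sym) ⟩
      skip x (π∖ w) y   ≡⟨ skip-miss {f = π∖ w} π∖wy≢x ⟩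
      π∖ w y            ∎

  non-adjacent-near : ∀ {x y} → x ≢ y → ∃₂ λ u v → u ≢ v × ¬ Adjacent (ν u v) u v
  non-adjacent-near {x} {y} x≢y with adjacent? (ν x y) x y
  ... | no xy-apart = x , y , x≢y , xy-apart
  ... | yes xy-adjacent with adjacent? (ν x (π∖ x y)) x (π∖ x y)
  ...   | no xw-apart = x , π∖ x y , π∖-avoids (x≢y ∘ sym) ∘ sym , xw-apart
  ...   | yes xw-adjacent with adjacent? (ν y (π∖ x y)) y (π∖ x y)
  ...     | no yw-apart =
    y , π∖ x y , π∖-avoids x≢y ∘ trans (adjacent⇒π∖-swap x≢y xy-adjacent) ∘ sym , yw-apart
  ...     | yes yw-adjacent = ⊥-elim (adjacent-triangle-impossible x≢y xy-adjacent xw-adjacent yw-adjacent)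

  non-adjacent-pair : ∃₂ λ x y → x ≢ y × ¬ Adjacent (ν x y) x y
  non-adjacent-pair with smaller-map-misses (s≤s (ℕ.≤-trans (s≤s z≤n) 4≤k)) (λ (_ : Fin 1) → fzero)
  ... | _ , missed = non-adjacent-near (missed fzero)

  module Propagation {μ : Point → Point} (μ-cyclic : IsCyclicPerm ⊤ μ) where

    skips-of-induced-agree : ∀ {z w} → Induces μ w → z ≢ w → SkipsAgree (_≢ z) (skip z μ) (π∖ z) w
    skips-of-induced-agree {z} {w} induces-w z≢w {a} a≢z a≢w = begin
      skip w (skip z μ) a  ≡⟨ skip-comm (μ-injective μ-cyclic) z≢w a≢z a≢w ⟩
      skip z (skip w μ) a  ≡⟨ skip-cong {f = skip w μ} {g = π∖ w} (induces-w a≢w)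
                                (induces-w (skip-avoids (μ-no-fixpoint μ-cyclic) w a)) ⟩
      skip z (π∖ w) a      ≡⟨ sym (π∖-skip-comm z≢w a≢z a≢w) ⟩
      skip w (π∖ z) a      ∎

    propagate : ∀ {u v z} → Induces μ u → Induces μ v → u ≢ v → ¬ Adjacent μ u v →
                z ≢ u → z ≢ v → ¬ Between μ u z v → ¬ Between μ v z u → Induces μ z
    propagate {u} {v} {z} induces-u induces-v u≢v u-v-apart z≢u z≢v ¬uzv ¬vzu =
      skips-determine (_≢ z) {ρ = skip z μ} {σ = π∖ z}
        (skip-injective (μ-injective μ-cyclic))
        (λ {a} _ → skip-no-fixpoint (μ-no-fixpoint μ-cyclic) (μ-no-2-cycle μ-cyclic) z a)
        (z≢u ∘ sym) (z≢v ∘ sym) u≢v (skip-nonadjacent u-v-apart ¬uzv ¬vzu)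
        (skips-of-induced-agree induces-u z≢u) (skips-of-induced-agree induces-v z≢v)

    -- Skipping z makes x and y adjacent; go through v = μ y, which is safely away from z.
    induces-between : ∀ {x y z} → Induces μ x → Induces μ y → x ≢ y → ¬ Adjacent μ x y →
                      Between μ x z y → Induces μ z
    induces-between {x} {y} {z} induces-x induces-y x≢y x-y-apart (μx≡z , μz≡y) =
      propagate induces-x induces-v x≢v x-v-apart z≢x z≢v ¬xzv ¬vzx
      where
      v : Point
      v = μ y
      μv≢x : μ v ≢ x
      μv≢x μv≡x = μ-no-4-cycle μ-cyclic x (begin
        μ (μ (μ (μ x)))  ≡⟨ cong (μ ∘ μ ∘ μ) μx≡z ⟩
        μ (μ (μ z))      ≡⟨ cong (μ ∘ μ) μz≡y ⟩
        μ v              ≡⟨ μv≡x ⟩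
        x                ∎)
      x≢v : x ≢ v
      x≢v = x-y-apart ∘ inj₂ ∘ sym
      v≢y : v ≢ y
      v≢y = μ-no-fixpoint μ-cyclic y
      z≢x : z ≢ x
      z≢x = μ-no-fixpoint μ-cyclic x ∘ trans μx≡z
      z≢v : z ≢ v
      z≢v = x≢y ∘ μ-injective μ-cyclic ∘ trans μx≡z
      induces-v : Induces μ v
      induces-v = propagate induces-x induces-y x≢y x-y-apart (x≢v ∘ sym) v≢y
        (z≢v ∘ trans (sym μx≡z) ∘ proj₁) (μv≢x ∘ proj₂)
      x-v-apart : ¬ Adjacent μ x v
      x-v-apart = [ z≢v ∘ trans (sym μx≡z) , μv≢x ]′
      ¬xzv : ¬ Between μ x z v
      ¬xzv (_ , μz≡v) = v≢y (trans (sym μz≡v) μz≡y)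
      ¬vzx : ¬ Between μ v z x
      ¬vzx (μv≡z , _) = x≢v (μ-injective μ-cyclic (trans μx≡z (sym μv≡z)))

    induces-everywhere : ∀ {x y} → Induces μ x → Induces μ y → x ≢ y → ¬ Adjacent μ x y →
                         ∀ z → Induces μ z
    induces-everywhere {x} {y} induces-x induces-y x≢y x-y-apart z
      with z ≟ x | z ≟ y | between? μ x z y | between? μ y z x
    ... | yes refl | _ | _ | _ = induces-x
    ... | no _ | yes refl | _ | _ = induces-y
    ... | no _ | no _ | yes xzy | _ = induces-between induces-x induces-y x≢y x-y-apart xzy
    ... | no _ | no _ | no _ | yes yzx =
      induces-between induces-y induces-x (x≢y ∘ sym) (x-y-apart ∘ swap) yzx
    ... | no z≢x | no z≢y | no ¬xzy | no ¬yzx =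
      propagate induces-x induces-y x≢y x-y-apart z≢x z≢y ¬xzy ¬yzx

lemma2 : (k : ℕ) → 4 ≤ k →
    (π : Subset (suc k) → Fin (suc k) → Fin (suc k)) →
    (∀ F → ∣ F ∣ ≡ k → IsCyclicPerm F (π F)) →
    (∀ F F′ → ∣ F ∣ ≡ k → ∣ F′ ∣ ≡ k → Compatible F (π F) F′ (π F′)) →
    ∃ λ τ → IsCyclicPerm ⊤ τ × (∀ F → ∣ F ∣ ≡ k → Compatible ⊤ τ F (π F))
lemma2 k 4≤k π π-cyclic π-compatible = extend non-adjacent-pair
  where
  open CompatibleFamily k 4≤k π π-cyclic π-compatible

  extend : (∃₂ λ x y → x ≢ y × ¬ Adjacent (ν x y) x y) →
           ∃ λ τ → IsCyclicPerm ⊤ τ × (∀ F → ∣ F ∣ ≡ k → Compatible ⊤ τ F (π F))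
  extend (x , y , x≢y , x-y-apart) = μ , μ-cyclic , compatible
    where
    μ : Fin (suc k) → Fin (suc k)
    μ = ν x y
    μ-cyclic : IsCyclicPerm ⊤ μ
    μ-cyclic = ν-cyclic x≢y

    induces : ∀ z → Induces μ z
    induces = Propagation.induces-everywhere μ-cyclic
      (ν-induces-left x≢y) (ν-induces-right x≢y) x≢y x-y-apart

    compatible : ∀ F → ∣ F ∣ ≡ k → Compatible ⊤ μ F (π F)
    compatible F ∣F∣≡k with ∣p∣≡n⇒all-but F ∣F∣≡k
    ... | z , refl = μ , subst (λ A → IsCyclicPerm A μ) (sym (∪-zeroˡ (all-but z))) μ-cyclic ,
                     restricts-to-self μ ⊤ , skip⇒restricts {τ = μ} (induces z)
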